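{- $U_{3,7}$ is an excluded minor for the class of quasi-graphic matroids, i.e., $U_{3,7}$ is not quasi-graphic but every proper minor of $U_{3,7}$ is quasi-graphic.
   Context: Graphs may have loops and parallel edges. For a graph $H$ and vertex $v$, $\mathrm{loops}_H(v)$ denotes the set of loops of $H$ at $v$. A graph $H$ is a framework for a matroid $N$ if (QG1) $E(H)=E(N)$; (QG2) $r_N(E(H'))\le |V(H')|$ for each component $H'$ of $H$; (QG3) for each vertex $v$ of $H$, $\mathrm{cl}_N(E(H-v))\subseteq E(H-v)\cup \mathrm{loops}_H(v)$; (QG4) for each circuit $C$ of $N$, the subgraph $H[C]$ has at most two components. A matroid is quasi-graphic if it has a framework. -}

module Defs where

open import Data.Nat using (ℕ; zero; suc; _+_; _∸_; _≤_; _⊓_; z≤n; s≤s)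
open import Data.Nat.Properties hiding (_≟_)
open import Data.Bool using (Bool; true; false; not; _∨_)
open import Data.Fin using (Fin; _≟_)
open import Data.Fin.Subset
  using (Subset; inside; outside; _∈_; _∉_; _⊆_; _⊂_; _∪_; _∩_; ∣_∣; ⁅_⁆; Empty; Nonempty)
open import Data.Fin.Subset.Properties using (p⊆q⇒∣p∣≤∣q∣; p∩q⊆p; p∩q⊆q; p⊆p∪q; q⊆p∪q)
open import Data.Vec using (Vec; []; _∷_; tabulate)
open import Data.Product using (Σ; Σ-syntax; ∃; ∃-syntax; _×_; _,_; proj₁; proj₂)
open import Data.Sum using (_⊎_; inj₁; inj₂)
open import Function.Bundles using (_⇔_)
open import Function.Definitions using (Injective)
open import Relation.Nullary using (¬_)
open import Relation.Nullary.Decidable using (⌊_⌋)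
open import Relation.Binary.PropositionalEquality using (_≡_; refl; sym; cong; subst)

record Matroid (m : ℕ) : Set where
  field
    rank        : Subset m → ℕ
    rank-bound  : ∀ X → rank X ≤ ∣ X ∣
    rank-mono   : ∀ {X Y} → X ⊆ Y → rank X ≤ rank Y
    rank-submod : ∀ X Y → rank (X ∪ Y) + rank (X ∩ Y) ≤ rank X + rank Y

open Matroid public

module _ {m : ℕ} (N : Matroid m) where

  Independent : Subset m → Set
  Independent X = rank N X ≡ ∣ X ∣

  Circuit : Subset m → Set
  Circuit C = ¬ Independent C × (∀ X → X ⊂ C → Independent X)

  InClosure : Subset m → Fin m → Set
  InClosure X e = rank N (X ∪ ⁅ e ⁆) ≡ rank N X

∣∪∣+∣∩∣ : ∀ {n} (p q : Subset n) → ∣ p ∪ q ∣ + ∣ p ∩ q ∣ ≡ ∣ p ∣ + ∣ q ∣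
∣∪∣+∣∩∣ [] [] = refl
∣∪∣+∣∩∣ (outside ∷ p) (outside ∷ q) = ∣∪∣+∣∩∣ p q
∣∪∣+∣∩∣ (inside ∷ p) (inside ∷ q)
  rewrite +-suc (∣ p ∪ q ∣) (∣ p ∩ q ∣) | ∣∪∣+∣∩∣ p q | +-suc (∣ p ∣) (∣ q ∣) = refl
∣∪∣+∣∩∣ (inside ∷ p) (outside ∷ q) = cong suc (∣∪∣+∣∩∣ p q)
∣∪∣+∣∩∣ (outside ∷ p) (inside ∷ q) rewrite ∣∪∣+∣∩∣ p q = sym (+-suc (∣ p ∣) (∣ q ∣))

private
  key : ∀ r a b u i → a + b ≡ u + i → i ≤ a → i ≤ b → a ≤ u → b ≤ u →
        r ⊓ u + r ⊓ i ≤ r ⊓ a + r ⊓ b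
  key r a b u i eq ia ib au bu with ≤-total r i
  ... | inj₁ ri
    rewrite m≤n⇒m⊓n≡m ri | m≤n⇒m⊓n≡m (≤-trans ri ia) | m≤n⇒m⊓n≡m (≤-trans ri ib)
          | m≤n⇒m⊓n≡m (≤-trans (≤-trans ri ia) au) = ≤-refl
  ... | inj₂ ir rewrite m≥n⇒m⊓n≡n ir with ≤-total u r
  ...   | inj₁ ur
    rewrite m≥n⇒m⊓n≡n ur | m≥n⇒m⊓n≡n (≤-trans au ur) | m≥n⇒m⊓n≡n (≤-trans bu ur)
      = ≤-reflexive (sym eq)
  ...   | inj₂ ru rewrite m≤n⇒m⊓n≡m ru with ≤-total r a
  ...     | inj₁ ra rewrite m≤n⇒m⊓n≡m ra = +-monoʳ-≤ r (⊓-glb ir ib)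
  ...     | inj₂ ar rewrite m≥n⇒m⊓n≡n ar with ≤-total r b
  ...       | inj₁ rb rewrite m≤n⇒m⊓n≡m rb | +-comm r i = +-monoˡ-≤ r ia
  ...       | inj₂ br rewrite m≥n⇒m⊓n≡n br | eq = +-monoˡ-≤ i ru

U : (r n : ℕ) → Matroid n
U r n = record
  { rank        = λ X → r ⊓ ∣ X ∣
  ; rank-bound  = λ X → m⊓n≤n r (∣ X ∣)
  ; rank-mono   = λ X⊆Y → ⊓-monoʳ-≤ r (p⊆q⇒∣p∣≤∣q∣ X⊆Y)
  ; rank-submod = λ X Y → key r (∣ X ∣) (∣ Y ∣) (∣ X ∪ Y ∣) (∣ X ∩ Y ∣)
      (sym (∣∪∣+∣∩∣ X Y))
      (p⊆q⇒∣p∣≤∣q∣ (p∩q⊆p X Y)) (p⊆q⇒∣p∣≤∣q∣ (p∩q⊆q X Y))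
      (p⊆q⇒∣p∣≤∣q∣ (p⊆p∪q {p = X} Y)) (p⊆q⇒∣p∣≤∣q∣ (q⊆p∪q X Y))
  }

U₃,₇ : Matroid 7
U₃,₇ = U 3 7

-- N is isomorphic to M / C \ D via the injection f : Fin m → Fin n whose
-- image is exactly E(M) - (C ∪ D); the rank function of M / C \ D is
-- X ↦ r_M(X ∪ C) - r_M(C).

IsMinorVia : ∀ {m n} → Matroid m → Matroid n → Subset n → Subset n → Set
IsMinorVia {m} {n} N M C D =
  Empty (C ∩ D) ×
  Σ[ f ∈ (Fin m → Fin n) ]
    ( Injective _≡_ _≡_ f
    × (∀ y → (y ∉ C × y ∉ D) ⇔ (∃[ x ] f x ≡ y))
    × (∀ (X : Subset m) (Y : Subset n) →
         (∀ y → y ∈ Y ⇔ (∃[ x ] (x ∈ X × f x ≡ y))) →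
         rank N X ≡ rank M (Y ∪ C) ∸ rank M C))

IsProperMinor : ∀ {m n} → Matroid m → Matroid n → Set
IsProperMinor {m} {n} N M =
  Σ[ C ∈ Subset n ] Σ[ D ∈ Subset n ] (Nonempty (C ∪ D) × IsMinorVia N M C D)

-- Graphs with V vertices and edge set Fin m (loops and parallel edges
-- allowed): each edge has an (unordered) pair of ends.

record Graph (V m : ℕ) : Set where
  field
    ends : Fin m → Fin V × Fin V

open Graph public

module _ {V m : ℕ} (H : Graph V m) where

  Joins : Fin m → Fin V → Fin V → Set
  Joins e u w = ends H e ≡ (u , w) ⊎ ends H e ≡ (w , u)

  Incident : Fin m → Fin V → Set
  Incident e v = proj₁ (ends H e) ≡ v ⊎ proj₂ (ends H e) ≡ v

  LoopAt : Fin m → Fin V → Set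
  LoopAt e v = ends H e ≡ (v , v)

  data Conn (X : Subset m) : Fin V → Fin V → Set where
    here : ∀ v → Conn X v v
    step : ∀ {u w v} e → e ∈ X → Joins e u w → Conn X w v → Conn X u v

  incidentᵇ : Fin m → Fin V → Bool
  incidentᵇ e v = ⌊ proj₁ (ends H e) ≟ v ⌋ ∨ ⌊ proj₂ (ends H e) ≟ v ⌋

  EdgesAvoiding : Fin V → Subset m
  EdgesAvoiding v = tabulate (λ e → not (incidentᵇ e v))

  allEdges : Subset m
  allEdges = tabulate (λ _ → inside)

module _ {V m : ℕ} (N : Matroid m) (H : Graph V m) where

  QG2 : Set
  QG2 = ∀ (u : Fin V) (S : Subset m) (T : Subset V) →
        (∀ e → e ∈ S ⇔ Conn H (allEdges H) u (proj₁ (ends H e))) →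
        (∀ v → v ∈ T ⇔ Conn H (allEdges H) u v) →
        rank N S ≤ ∣ T ∣

  QG3 : Set
  QG3 = ∀ (v : Fin V) (e : Fin m) → InClosure N (EdgesAvoiding H v) e →
        e ∈ EdgesAvoiding H v ⊎ LoopAt H e v

  -- (QG4): for each circuit C, H[C] (edges C, vertices incident with C)
  -- has at most two components: all its vertices lie in the components
  -- of two vertices a, b.
  QG4 : Set
  QG4 = ∀ (C : Subset m) → Circuit N C →
        Σ[ a ∈ Fin V ] Σ[ b ∈ Fin V ]
          (∀ v → (∃[ e ] (e ∈ C × Incident H e v)) → Conn H C a v ⊎ Conn H C b v)

  -- (QG1) holds by construction: E(H) = Fin m = E(N).
  IsFramework : Set
  IsFramework = QG2 × QG3 × QG4

QuasiGraphic : ∀ {m} → Matroid m → Set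
QuasiGraphic {m} N = Σ[ V ∈ ℕ ] Σ[ H ∈ Graph V m ] IsFramework N H

-- In a framework H for U_{3,n} with n ≥ 7, (QG3) forces every vertex v met by a non-loop edge
-- to be avoided by at most two edges: otherwise the edges of H - v span, and the non-loop edge
-- would lie in their closure. So if uw is a non-loop edge, the component of u contains at least
-- n - 2 ≥ 5 edges, has rank 3, and by (QG2) has a third vertex x, which also meets a non-loop
-- edge; as every edge avoids one of u, w, x, this gives n ≤ 6. If all edges are loops, then
-- components are single vertices, (QG2) allows one loop per vertex, and (QG4) for a 4-element
-- circuit puts three of its loops on two vertices.
-- A proper minor of U_{3,7} is U_{3-c,m} with c contracted elements and m ≤ 6. It is framed by
-- a bouquet of loops when 3 - c ≤ 1, by two vertices joined by parallel edges when 3 - c = 2,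
-- and by a triangle with at most two parallel edges per side when c = 0.
module Submission where

open import Defs
open import Data.Bool using (Bool; true; not; _∨_)
open import Data.Empty using (⊥-elim) renaming (⊥ to Empty⊥)
open import Data.Fin using (Fin; zero; suc; toℕ; fromℕ<; _≟_)
open import Data.Fin.Properties using (any?; all?; suc-injective; toℕ-fromℕ<)
open import Data.Fin.Subset
  using (Subset; inside; outside; _∈_; _∉_; _⊆_; _∪_; _∩_; ∣_∣; ⁅_⁆; ⊥; ⊤; Empty; Nonempty)
open import Data.Fin.Subset.Properties
open import Data.Nat using (ℕ; zero; suc; _+_; _∸_; _⊓_; _≤_; _<_; z≤n; s≤s; s≤s⁻¹; _≤?_)
open import Data.Nat.DivMod using (_mod_)
open import Data.Nat.Properties hiding (_≟_; suc-injective)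
open import Data.Product using (∃-syntax; _×_; _,_; proj₁; proj₂)
open import Data.Sum as Sum using (_⊎_; inj₁; inj₂; [_,_])
open import Data.Vec using ([]; _∷_; tabulate; _[_]=_)
open _[_]=_
open import Data.Vec.Properties using (lookup∘tabulate; []=⇒lookup; lookup⇒[]=)
open import Function using (_∘_)
open import Function.Bundles using (_⇔_; mk⇔; Equivalence)
open import Function.Definitions using (Injective)
import Function.Properties.Equivalence as ⇔
open import Relation.Nullary using (¬_; Dec; yes; no; contradiction)
open import Relation.Nullary.Decidable
  using (⌊_⌋; ¬?; _×-dec_; toWitness; decidable-stable; ¬¬-excluded-middle)
open import Relation.Binary.PropositionalEquality hiding ([_])

open Equivalence using (to; from)

∈-tabulate⇔ : ∀ {n} (g : Fin n → Bool) x → x ∈ tabulate g ⇔ g x ≡ true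
∈-tabulate⇔ g x = mk⇔
  (λ x∈ → trans (sym (lookup∘tabulate g x)) ([]=⇒lookup x∈))
  (λ gx≡true → lookup⇒[]= x _ (trans (lookup∘tabulate g x) gx≡true))

isYes≡true⇔ : ∀ {P : Set} (P? : Dec P) → ⌊ P? ⌋ ≡ true ⇔ P
isYes≡true⇔ (yes p) = mk⇔ (λ _ → p) (λ _ → refl)
isYes≡true⇔ (no ¬p) = mk⇔ (λ ()) (λ p → contradiction p ¬p)

not-∨-isYes⇔ : ∀ {P Q : Set} (P? : Dec P) (Q? : Dec Q) →
               not (⌊ P? ⌋ ∨ ⌊ Q? ⌋) ≡ true ⇔ (¬ (P ⊎ Q))
not-∨-isYes⇔ (yes p) _       = mk⇔ (λ ()) (λ ¬p⊎q → contradiction (inj₁ p) ¬p⊎q)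
not-∨-isYes⇔ (no _)  (yes q) = mk⇔ (λ ()) (λ ¬p⊎q → contradiction (inj₂ q) ¬p⊎q)
not-∨-isYes⇔ (no ¬p) (no ¬q) = mk⇔ (λ _ → [ ¬p , ¬q ]) (λ _ → refl)

∈-tabulate-isYes⇔ : ∀ {n} {P : Fin n → Set} (P? : ∀ x → Dec (P x)) x →
                    x ∈ tabulate (λ y → ⌊ P? y ⌋) ⇔ P x
∈-tabulate-isYes⇔ P? x = ⇔.trans (∈-tabulate⇔ _ x) (isYes≡true⇔ (P? x))

Empty⇒∣p∣≡0 : ∀ {n} {p : Subset n} → Empty p → ∣ p ∣ ≡ 0
Empty⇒∣p∣≡0 {n} p-empty = trans (cong ∣_∣ (Empty-unique p-empty)) (∣⊥∣≡0 n)

∣p∪q∣≤∣p∣+∣q∣ : ∀ {n} (p q : Subset n) → ∣ p ∪ q ∣ ≤ ∣ p ∣ + ∣ q ∣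
∣p∪q∣≤∣p∣+∣q∣ p q = subst (∣ p ∪ q ∣ ≤_) (∣∪∣+∣∩∣ p q) (m≤m+n _ _)

∣p∪q∣≡∣p∣+∣q∣ : ∀ {n} (p q : Subset n) → (∀ {x} → x ∈ p → x ∉ q) →
                ∣ p ∪ q ∣ ≡ ∣ p ∣ + ∣ q ∣
∣p∪q∣≡∣p∣+∣q∣ p q disjoint = begin
  ∣ p ∪ q ∣               ≡⟨ +-identityʳ _ ⟨
  ∣ p ∪ q ∣ + 0           ≡⟨ cong (∣ p ∪ q ∣ +_) ∣p∩q∣≡0 ⟨
  ∣ p ∪ q ∣ + ∣ p ∩ q ∣   ≡⟨ ∣∪∣+∣∩∣ p q ⟩
  ∣ p ∣ + ∣ q ∣           ∎
  where
  open ≡-Reasoning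
  ∣p∩q∣≡0 : ∣ p ∩ q ∣ ≡ 0
  ∣p∩q∣≡0 = Empty⇒∣p∣≡0 λ (x , x∈p∩q) →
    let (x∈p , x∈q) = x∈p∩q⁻ p q x∈p∩q in disjoint x∈p x∈q

x∈p⇒0<∣p∣ : ∀ {n} {x : Fin n} {p : Subset n} → x ∈ p → 0 < ∣ p ∣
x∈p⇒0<∣p∣ {x = x} {p} x∈p = subst (_≤ ∣ p ∣) (∣⁅x⁆∣≡1 x)
  (p⊆q⇒∣p∣≤∣q∣ λ y∈⁅x⁆ → subst (_∈ p) (sym (x∈⁅y⁆⇒x≡y x y∈⁅x⁆)) x∈p)

x≢y⇒1<∣p∣ : ∀ {n} {x y : Fin n} {p : Subset n} → x ∈ p → y ∈ p → x ≢ y → 1 < ∣ p ∣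
x≢y⇒1<∣p∣ x∈p y∈p x≢y =
  ≤-<-trans (x∈p⇒0<∣p∣ (x∈p∧x≢y⇒x∈p-y y∈p (x≢y ∘ sym))) (x∈p⇒∣p-x∣<∣p∣ x∈p)

∀∈⇒n≤∣p∣ : ∀ {n} {p : Subset n} → (∀ x → x ∈ p) → n ≤ ∣ p ∣
∀∈⇒n≤∣p∣ {n} {p} all∈p = subst (_≤ ∣ p ∣) (∣⊤∣≡n n) (p⊆q⇒∣p∣≤∣q∣ {p = ⊤} λ {x} _ → all∈p x)

covered⇒n≤∣p∣+∣q∣ : ∀ {n} {p q : Subset n} → (∀ x → x ∈ p ⊎ x ∈ q) → n ≤ ∣ p ∣ + ∣ q ∣
covered⇒n≤∣p∣+∣q∣ {p = p} {q} cover =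
  ≤-trans (∀∈⇒n≤∣p∣ (x∈p∪q⁺ ∘ cover)) (∣p∪q∣≤∣p∣+∣q∣ p q)

covered⇒n≤∣p∣+∣q∣+∣r∣ : ∀ {n} {p q r : Subset n} → (∀ x → x ∈ p ⊎ x ∈ q ⊎ x ∈ r) →
                        n ≤ ∣ p ∣ + (∣ q ∣ + ∣ r ∣)
covered⇒n≤∣p∣+∣q∣+∣r∣ {p = p} {q} {r} cover =
  ≤-trans (covered⇒n≤∣p∣+∣q∣ (Sum.map₂ x∈p∪q⁺ ∘ cover)) (+-monoʳ-≤ ∣ p ∣ (∣p∪q∣≤∣p∣+∣q∣ q r))

⊆pair⇒∣p∣≤2 : ∀ {n} {p : Subset n} {u w} → (∀ {x} → x ∈ p → x ≡ u ⊎ x ≡ w) → ∣ p ∣ ≤ 2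
⊆pair⇒∣p∣≤2 {u = u} {w} ⊆pair = begin
  _                       ≤⟨ p⊆q⇒∣p∣≤∣q∣ (x∈p∪q⁺ ∘ Sum.map (from x∈⁅y⁆⇔x≡y) (from x∈⁅y⁆⇔x≡y) ∘ ⊆pair) ⟩
  ∣ ⁅ u ⁆ ∪ ⁅ w ⁆ ∣       ≤⟨ ∣p∪q∣≤∣p∣+∣q∣ ⁅ u ⁆ ⁅ w ⁆ ⟩
  ∣ ⁅ u ⁆ ∣ + ∣ ⁅ w ⁆ ∣   ≡⟨ cong₂ _+_ (∣⁅x⁆∣≡1 u) (∣⁅x⁆∣≡1 w) ⟩
  2                       ∎
  where open ≤-Reasoning

2<∣p∣⇒∃-other : ∀ {n} {p : Subset n} u w → 2 < ∣ p ∣ → ∃[ x ] (x ∈ p × x ≢ u × x ≢ w)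
2<∣p∣⇒∃-other {p = p} u w 2<∣p∣
  with any? (λ x → x ∈? p ×-dec ¬? (x ≟ u) ×-dec ¬? (x ≟ w))
... | yes other = other
... | no ¬other = contradiction (⊆pair⇒∣p∣≤2 ⊆pair) (<⇒≱ 2<∣p∣)
  where
  ⊆pair : ∀ {x} → x ∈ p → x ≡ u ⊎ x ≡ w
  ⊆pair {x} x∈p with x ≟ u | x ≟ w
  ... | yes x≡u | _       = inj₁ x≡u
  ... | no _    | yes x≡w = inj₂ x≡w
  ... | no x≢u  | no x≢w  = ⊥-elim (¬other (x , x∈p , x≢u , x≢w))

∣p∣<n⇒∃∉ : ∀ {n} {p : Subset n} → ∣ p ∣ < n → ∃[ x ] x ∉ p
∣p∣<n⇒∃∉ {p = p} ∣p∣<n with any? (λ x → ¬? (x ∈? p))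
... | yes outsider = outsider
... | no ¬outsider = contradiction (∀∈⇒n≤∣p∣ λ x → decidable-stable (x ∈? p) (¬outsider ∘ (x ,_)))
                                   (<⇒≱ ∣p∣<n)

pigeonhole : ∀ {A : Set} {a b x y z : A} → a ≡ x ⊎ b ≡ x → a ≡ y ⊎ b ≡ y → a ≡ z ⊎ b ≡ z →
             x ≡ y ⊎ x ≡ z ⊎ y ≡ z
pigeonhole (inj₁ refl) (inj₁ refl) _           = inj₁ refl
pigeonhole (inj₂ refl) (inj₂ refl) _           = inj₁ refl
pigeonhole (inj₁ refl) (inj₂ refl) (inj₁ refl) = inj₂ (inj₁ refl)
pigeonhole (inj₁ refl) (inj₂ refl) (inj₂ refl) = inj₂ (inj₂ refl)
pigeonhole (inj₂ refl) (inj₁ refl) (inj₁ refl) = inj₂ (inj₂ refl)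
pigeonhole (inj₂ refl) (inj₁ refl) (inj₂ refl) = inj₂ (inj₁ refl)

r⊓[c+k]∸r⊓c≡[r∸c]⊓k : ∀ r c k → r ⊓ (c + k) ∸ r ⊓ c ≡ (r ∸ c) ⊓ k
r⊓[c+k]∸r⊓c≡[r∸c]⊓k zero    zero    k = refl
r⊓[c+k]∸r⊓c≡[r∸c]⊓k zero    (suc c) k = refl
r⊓[c+k]∸r⊓c≡[r∸c]⊓k (suc r) zero    k = refl
r⊓[c+k]∸r⊓c≡[r∸c]⊓k (suc r) (suc c) k = r⊓[c+k]∸r⊓c≡[r∸c]⊓k r c k

m⊓n≤o⇒n≤o : ∀ {m n o} → o < m → m ⊓ n ≤ o → n ≤ o
m⊓n≤o⇒n≤o {m} {n} o<m m⊓n≤o with ≤-total m n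
... | inj₁ m≤n = contradiction (subst (_≤ _) (m≤n⇒m⊓n≡m m≤n) m⊓n≤o) (<⇒≱ o<m)
... | inj₂ n≤m = subst (_≤ _) (m≥n⇒m⊓n≡n n≤m) m⊓n≤o

¬¬-∀-Fin : ∀ n {P : Fin n → Set} → (∀ i → ¬ ¬ P i) → ¬ ¬ (∀ i → P i)
¬¬-∀-Fin zero    _     ¬∀ = ¬∀ λ ()
¬¬-∀-Fin (suc n) ¬¬P ¬∀ = ¬¬P zero λ P₀ → ¬¬-∀-Fin n (¬¬P ∘ suc) λ P₊ →
  ¬∀ λ { zero → P₀ ; (suc i) → P₊ i }

-- Uniform matroids and their minors

U-spanning⇒closure : ∀ {r n} (X : Subset n) e → r ≤ ∣ X ∣ → InClosure (U r n) X e
U-spanning⇒closure X e r≤∣X∣ =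
  trans (m≤n⇒m⊓n≡m (≤-trans r≤∣X∣ (∣p∣≤∣p∪q∣ X ⁅ e ⁆))) (sym (m≤n⇒m⊓n≡m r≤∣X∣))

U-independent⇒¬closure : ∀ {r n} {X : Subset n} {e} → ∣ X ∣ < r → e ∉ X →
                         ¬ InClosure (U r n) X e
U-independent⇒¬closure {r} {X = X} {e} ∣X∣<r e∉X e∈cl = m+1+n≢m ∣ X ∣ (begin
  ∣ X ∣ + 1             ≡⟨ m≥n⇒m⊓n≡n (subst (_≤ r) (+-comm 1 ∣ X ∣) ∣X∣<r) ⟨
  r ⊓ (∣ X ∣ + 1)       ≡⟨ cong (r ⊓_) ∣X∪⁅e⁆∣≡∣X∣+1 ⟨
  r ⊓ ∣ X ∪ ⁅ e ⁆ ∣     ≡⟨ e∈cl ⟩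
  r ⊓ ∣ X ∣             ≡⟨ m≥n⇒m⊓n≡n (<⇒≤ ∣X∣<r) ⟩
  ∣ X ∣                 ∎)
  where
  open ≡-Reasoning
  ∣X∪⁅e⁆∣≡∣X∣+1 : ∣ X ∪ ⁅ e ⁆ ∣ ≡ ∣ X ∣ + 1
  ∣X∪⁅e⁆∣≡∣X∣+1 = trans
    (∣p∪q∣≡∣p∣+∣q∣ X ⁅ e ⁆ λ x∈X x∈⁅e⁆ → e∉X (subst (_∈ X) (x∈⁅y⁆⇒x≡y e x∈⁅e⁆) x∈X))
    (cong (∣ X ∣ +_) (∣⁅x⁆∣≡1 e))

U-circuit : ∀ {r n} {C : Subset n} → ∣ C ∣ ≡ suc r → Circuit (U r n) C
U-circuit {r} ∣C∣≡1+r = dependent , λ X X⊂C →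
  m≥n⇒m⊓n≡n (s≤s⁻¹ (subst (_ <_) ∣C∣≡1+r (p⊂q⇒∣p∣<∣q∣ X⊂C)))
  where
  dependent : ¬ (r ⊓ _ ≡ _)
  dependent independent = 1+n≢n (sym (begin
    r               ≡⟨ m≤n⇒m⊓n≡m (n≤1+n r) ⟨
    r ⊓ suc r       ≡⟨ cong (r ⊓_) ∣C∣≡1+r ⟨
    r ⊓ _           ≡⟨ trans independent ∣C∣≡1+r ⟩
    suc r           ∎))
    where open ≡-Reasoning

quasiGraphic-resp : ∀ {m} {M N : Matroid m} → (∀ X → rank M X ≡ rank N X) →
                    QuasiGraphic M → QuasiGraphic N
quasiGraphic-resp {M = M} {N} M≗N (V , H , qg2 , qg3 , qg4) = V , H , qg2′ , qg3′ , qg4′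
  where
  qg2′ : QG2 N H
  qg2′ u S T S-edges T-vertices = subst (_≤ _) (M≗N S) (qg2 u S T S-edges T-vertices)
  qg3′ : QG3 N H
  qg3′ v e e∈cl = qg3 v e (trans (M≗N _) (trans e∈cl (sym (M≗N _))))
  qg4′ : QG4 N H
  qg4′ C (dependent , minimal) =
    qg4 C (dependent ∘ trans (sym (M≗N C)) , λ X X⊂C → trans (M≗N X) (minimal X X⊂C))

image : ∀ {m n} → (Fin m → Fin n) → Subset m → Subset n
image f []            = ⊥
image f (outside ∷ X) = image (f ∘ suc) X
image f (inside ∷ X)  = ⁅ f zero ⁆ ∪ image (f ∘ suc) X

∈-image⁺ : ∀ {m n} (f : Fin m → Fin n) X {x} → x ∈ X → f x ∈ image f X
∈-image⁺ f (inside ∷ X)  here        = x∈p∪q⁺ (inj₁ (x∈⁅x⁆ (f zero)))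
∈-image⁺ f (outside ∷ X) (there x∈X) = ∈-image⁺ (f ∘ suc) X x∈X
∈-image⁺ f (inside ∷ X)  (there x∈X) = x∈p∪q⁺ (inj₂ (∈-image⁺ (f ∘ suc) X x∈X))

∈-image⁻ : ∀ {m n} (f : Fin m → Fin n) X {y} → y ∈ image f X → ∃[ x ] (x ∈ X × f x ≡ y)
∈-image⁻ f []            y∈ = contradiction y∈ ∉⊥
∈-image⁻ f (outside ∷ X) y∈ =
  let (x , x∈X , fx≡y) = ∈-image⁻ (f ∘ suc) X y∈ in suc x , there x∈X , fx≡y
∈-image⁻ f (inside ∷ X)  y∈ with x∈p∪q⁻ ⁅ f zero ⁆ (image (f ∘ suc) X) y∈
... | inj₁ y∈⁅f0⁆ = zero , here , sym (x∈⁅y⁆⇒x≡y _ y∈⁅f0⁆)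
... | inj₂ y∈rest =
  let (x , x∈X , fx≡y) = ∈-image⁻ (f ∘ suc) X y∈rest in suc x , there x∈X , fx≡y

∈-image⇔ : ∀ {m n} (f : Fin m → Fin n) X y → y ∈ image f X ⇔ (∃[ x ] (x ∈ X × f x ≡ y))
∈-image⇔ f X y = mk⇔ (∈-image⁻ f X) λ { (x , x∈X , refl) → ∈-image⁺ f X x∈X }

∣image∣≡∣X∣ : ∀ {m n} (f : Fin m → Fin n) → Injective _≡_ _≡_ f → ∀ X → ∣ image f X ∣ ≡ ∣ X ∣
∣image∣≡∣X∣ {n = n} f f-injective []            = ∣⊥∣≡0 n
∣image∣≡∣X∣         f f-injective (outside ∷ X) =
  ∣image∣≡∣X∣ (f ∘ suc) (suc-injective ∘ f-injective) X
∣image∣≡∣X∣         f f-injective (inside ∷ X)  = trans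
  (∣p∪q∣≡∣p∣+∣q∣ ⁅ f zero ⁆ (image (f ∘ suc) X) f0∉rest)
  (cong₂ _+_ (∣⁅x⁆∣≡1 (f zero)) (∣image∣≡∣X∣ (f ∘ suc) (suc-injective ∘ f-injective) X))
  where
  f0∉rest : ∀ {y} → y ∈ ⁅ f zero ⁆ → y ∉ image (f ∘ suc) X
  f0∉rest y∈⁅f0⁆ y∈rest with ∈-image⁻ (f ∘ suc) X y∈rest
  ... | x , _ , fx≡y with f-injective (trans fx≡y (x∈⁅y⁆⇒x≡y _ y∈⁅f0⁆))
  ...   | ()

uniform-minor : ∀ {r m n} {N : Matroid m} {C D : Subset n} → IsMinorVia N (U r n) C D →
                (∀ X → rank N X ≡ rank (U (r ∸ ∣ C ∣) m) X) × ∣ C ∪ D ∣ + m ≤ n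
uniform-minor {r} {m} {n} {N} {C} {D} (_ , f , f-injective , f-image , rank-N) =
  rank-N≡ , size
  where
  image-avoids : ∀ X {y} → y ∈ image f X → y ∉ C × y ∉ D
  image-avoids X y∈ = let (x , _ , fx≡y) = ∈-image⁻ f X y∈ in
    subst (λ y → y ∉ C × y ∉ D) fx≡y (from (f-image (f x)) (x , refl))

  rank-N≡ : ∀ X → rank N X ≡ (r ∸ ∣ C ∣) ⊓ ∣ X ∣
  rank-N≡ X = begin
    rank N X                           ≡⟨ rank-N X (image f X) (∈-image⇔ f X) ⟩
    r ⊓ ∣ image f X ∪ C ∣ ∸ r ⊓ ∣ C ∣  ≡⟨ cong (λ i → r ⊓ i ∸ r ⊓ ∣ C ∣) ∣image∪C∣ ⟩
    r ⊓ (∣ X ∣ + ∣ C ∣) ∸ r ⊓ ∣ C ∣    ≡⟨ cong (λ i → r ⊓ i ∸ r ⊓ ∣ C ∣) (+-comm ∣ X ∣ ∣ C ∣) ⟩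
    r ⊓ (∣ C ∣ + ∣ X ∣) ∸ r ⊓ ∣ C ∣    ≡⟨ r⊓[c+k]∸r⊓c≡[r∸c]⊓k r ∣ C ∣ ∣ X ∣ ⟩
    (r ∸ ∣ C ∣) ⊓ ∣ X ∣                ∎
    where
    open ≡-Reasoning
    ∣image∪C∣ : ∣ image f X ∪ C ∣ ≡ ∣ X ∣ + ∣ C ∣
    ∣image∪C∣ = trans (∣p∪q∣≡∣p∣+∣q∣ _ C (proj₁ ∘ image-avoids X))
                      (cong (_+ ∣ C ∣) (∣image∣≡∣X∣ f f-injective X))

  size : ∣ C ∪ D ∣ + m ≤ n
  size = begin
    ∣ C ∪ D ∣ + m                ≡⟨ cong (∣ C ∪ D ∣ +_) (trans (∣image∣≡∣X∣ f f-injective ⊤) (∣⊤∣≡n m)) ⟨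
    ∣ C ∪ D ∣ + ∣ image f ⊤ ∣    ≡⟨ ∣p∪q∣≡∣p∣+∣q∣ (C ∪ D) _ C∪D∉image ⟨
    ∣ (C ∪ D) ∪ image f ⊤ ∣      ≤⟨ ∣p∣≤n ((C ∪ D) ∪ image f ⊤) ⟩
    n                            ∎
    where
    open ≤-Reasoning
    C∪D∉image : ∀ {y} → y ∈ C ∪ D → y ∉ image f ⊤
    C∪D∉image y∈C∪D y∈image with image-avoids ⊤ y∈image | x∈p∪q⁻ C D y∈C∪D
    ... | y∉C , _   | inj₁ y∈C = y∉C y∈C
    ... | _   , y∉D | inj₂ y∈D = y∉D y∈D

-- Graphs

module _ {V m : ℕ} {H : Graph V m} where

  Conn-trans : ∀ {X a b c} → Conn H X a b → Conn H X b c → Conn H X a c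
  Conn-trans (here _)                p = p
  Conn-trans (step e e∈X joins rest) p = step e e∈X joins (Conn-trans rest p)

  Joins-sym : ∀ {e u w} → Joins H e u w → Joins H e w u
  Joins-sym = Sum.swap

  Conn-sym : ∀ {X a b} → Conn H X a b → Conn H X b a
  Conn-sym (here v)                = here v
  Conn-sym (step e e∈X joins rest) = Conn-trans (Conn-sym rest) (step e e∈X (Joins-sym joins) (here _))

module GraphLemmas {V m : ℕ} (H : Graph V m) where

  end₁ end₂ : Fin m → Fin V
  end₁ e = proj₁ (ends H e)
  end₂ e = proj₂ (ends H e)

  IsLoop : Fin m → Set
  IsLoop e = end₁ e ≡ end₂ e

  ComponentEdges : Fin V → Subset m → Set
  ComponentEdges u S = ∀ e → e ∈ S ⇔ Conn H (allEdges H) u (end₁ e)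

  ComponentVertices : Fin V → Subset V → Set
  ComponentVertices u T = ∀ v → v ∈ T ⇔ Conn H (allEdges H) u v

  ∈allEdges : ∀ e → e ∈ allEdges H
  ∈allEdges e = from (∈-tabulate⇔ _ e) refl

  Conn-edge : ∀ {X e} → e ∈ X → Conn H X (end₁ e) (end₂ e)
  Conn-edge e∈X = step _ e∈X (inj₁ refl) (here _)

  Joins⇒Incident : ∀ {e u w} → Joins H e u w → Incident H e u
  Joins⇒Incident (inj₁ ends≡uw) = inj₁ (cong proj₁ ends≡uw)
  Joins⇒Incident (inj₂ ends≡wu) = inj₂ (cong proj₂ ends≡wu)

  Joins⇒¬IsLoop : ∀ {e u w} → Joins H e u w → u ≢ w → ¬ IsLoop e
  Joins⇒¬IsLoop (inj₁ ends≡uw) u≢w loop =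
    u≢w (trans (sym (cong proj₁ ends≡uw)) (trans loop (cong proj₂ ends≡uw)))
  Joins⇒¬IsLoop (inj₂ ends≡wu) u≢w loop =
    u≢w (trans (sym (cong proj₂ ends≡wu)) (trans (sym loop) (cong proj₁ ends≡wu)))

  Conn⇒incident-nonLoop : ∀ {X a b} → Conn H X a b → a ≢ b →
                          ∃[ e ] (Incident H e a × ¬ IsLoop e)
  Conn⇒incident-nonLoop (here _) a≢a = contradiction refl a≢a
  Conn⇒incident-nonLoop {a = a} (step {w = w} e _ joins rest) a≢b with a ≟ w
  ... | yes refl = Conn⇒incident-nonLoop rest a≢b
  ... | no a≢w   = e , Joins⇒Incident joins , Joins⇒¬IsLoop joins a≢w

  loops⇒Conn⇒≡ : (∀ e → IsLoop e) → ∀ {X a b} → Conn H X a b → a ≡ b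
  loops⇒Conn⇒≡ loops (here _)             = refl
  loops⇒Conn⇒≡ loops (step e _ joins rest) =
    trans (decidable-stable (_ ≟ _) (λ u≢w → Joins⇒¬IsLoop joins u≢w (loops e)))
          (loops⇒Conn⇒≡ loops rest)

  ∈EdgesAvoiding⇔ : ∀ {e v} → e ∈ EdgesAvoiding H v ⇔ (¬ Incident H e v)
  ∈EdgesAvoiding⇔ {e} {v} = ⇔.trans (∈-tabulate⇔ _ e) (not-∨-isYes⇔ (end₁ e ≟ v) (end₂ e ≟ v))

  avoids⊎incident : ∀ e v → e ∈ EdgesAvoiding H v ⊎ Incident H e v
  avoids⊎incident e v with end₁ e ≟ v | end₂ e ≟ v
  ... | yes e₁≡v | _       = inj₂ (inj₁ e₁≡v)
  ... | no _     | yes e₂≡v = inj₂ (inj₂ e₂≡v)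
  ... | no e₁≢v  | no e₂≢v = inj₁ (from ∈EdgesAvoiding⇔ [ e₁≢v , e₂≢v ])

  avoids-one-of-three : ∀ {u w x} → u ≢ w → u ≢ x → w ≢ x → ∀ e →
    e ∈ EdgesAvoiding H u ⊎ e ∈ EdgesAvoiding H w ⊎ e ∈ EdgesAvoiding H x
  avoids-one-of-three {u} {w} {x} u≢w u≢x w≢x e
    with avoids⊎incident e u | avoids⊎incident e w | avoids⊎incident e x
  ... | inj₁ avoids-u | _             | _             = inj₁ avoids-u
  ... | inj₂ _        | inj₁ avoids-w | _             = inj₂ (inj₁ avoids-w)
  ... | inj₂ _        | inj₂ _        | inj₁ avoids-x = inj₂ (inj₂ avoids-x)
  ... | inj₂ at-u     | inj₂ at-w     | inj₂ at-x     =
    ⊥-elim ([ u≢w , [ u≢x , w≢x ] ] (pigeonhole at-u at-w at-x))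

  component-ends : ∀ {u S T e} → ComponentEdges u S → ComponentVertices u T → e ∈ S →
                   end₁ e ∈ T × end₂ e ∈ T
  component-ends S-edges T-vertices e∈S =
    let u~e₁ = to (S-edges _) e∈S in
    from (T-vertices _) u~e₁ , from (T-vertices _) (Conn-trans u~e₁ (Conn-edge (∈allEdges _)))

  component-avoids : ∀ {u S T w} → ComponentEdges u S → ComponentVertices u T → w ∉ T →
                     S ⊆ EdgesAvoiding H w
  component-avoids S-edges T-vertices w∉T e∈S = from ∈EdgesAvoiding⇔ λ incident →
    let (e₁∈T , e₂∈T) = component-ends S-edges T-vertices e∈S in
    w∉T ([ (λ e₁≡w → subst (_∈ _) e₁≡w e₁∈T) , (λ e₂≡w → subst (_∈ _) e₂≡w e₂∈T) ] incident)

  component-nonLoop⇒1<∣T∣ : ∀ {u S T e} → ComponentEdges u S → ComponentVertices u T →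
                            e ∈ S → ¬ IsLoop e → 1 < ∣ T ∣
  component-nonLoop⇒1<∣T∣ S-edges T-vertices e∈S nonLoop =
    let (e₁∈T , e₂∈T) = component-ends S-edges T-vertices e∈S in x≢y⇒1<∣p∣ e₁∈T e₂∈T nonLoop

module _ {V m : ℕ} {N : Matroid m} {H : Graph V m} where
  open GraphLemmas H

  QG3⇒nonLoop∉closure : QG3 N H → ∀ {e v} → Incident H e v → ¬ IsLoop e →
                        ¬ InClosure N (EdgesAvoiding H v) e
  QG3⇒nonLoop∉closure qg3 {e} {v} incident nonLoop e∈cl with qg3 v e e∈cl
  ... | inj₁ avoids   = to ∈EdgesAvoiding⇔ avoids incident
  ... | inj₂ loopAt-v = nonLoop (trans (cong proj₁ loopAt-v) (sym (cong proj₂ loopAt-v)))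

module _ {V m r : ℕ} {H : Graph V m} where
  open GraphLemmas H

  U-QG2 : (∀ {u S T} → ComponentEdges u S → ComponentVertices u T → Nonempty S →
             r ⊓ ∣ S ∣ ≤ ∣ T ∣) →
          QG2 (U r m) H
  U-QG2 nonempty-case u S T S-edges T-vertices with nonempty? S
  ... | yes S-nonempty = nonempty-case S-edges T-vertices S-nonempty
  ... | no S-empty     =
    ≤-trans (m⊓n≤n r ∣ S ∣) (subst (_≤ ∣ T ∣) (sym (Empty⇒∣p∣≡0 S-empty)) z≤n)

  U-QG3 : (∀ v → ∣ EdgesAvoiding H v ∣ < r) → QG3 (U r m) H
  U-QG3 small v e e∈cl with e ∈? EdgesAvoiding H v
  ... | yes avoids = inj₁ avoids
  ... | no ¬avoids = contradiction e∈cl (U-independent⇒¬closure (small v) ¬avoids)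

-- Frameworks for the proper minors

bouquet : ∀ m → Graph 1 m
bouquet m = record { ends = λ _ → zero , zero }

rank≤1⇒quasiGraphic : ∀ {m} {N : Matroid m} → (∀ X → rank N X ≤ 1) → QuasiGraphic N
rank≤1⇒quasiGraphic {m} {N} rank≤1 = 1 , bouquet m , qg2 , qg3 , qg4
  where
  qg2 : QG2 N (bouquet m)
  qg2 u S T _ T-vertices = ≤-trans (rank≤1 S) (x∈p⇒0<∣p∣ (from (T-vertices u) (here u)))
  qg3 : QG3 N (bouquet m)
  qg3 zero _ _ = inj₂ refl
  qg4 : QG4 N (bouquet m)
  qg4 _ _ = zero , zero , λ { zero _ → inj₁ (here zero) }

parallel : ∀ m → Graph 2 m
parallel m = record { ends = λ _ → zero , suc zero }

U₂-quasiGraphic : ∀ m → QuasiGraphic (U 2 m)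
U₂-quasiGraphic m = 2 , parallel m , U-QG2 qg2 , U-QG3 avoiding-empty , qg4
  where
  open GraphLemmas (parallel m)
  qg2 : ∀ {u S T} → ComponentEdges u S → ComponentVertices u T → Nonempty S → 2 ⊓ ∣ S ∣ ≤ ∣ T ∣
  qg2 S-edges T-vertices (e , e∈S) =
    ≤-trans (m⊓n≤m 2 _) (component-nonLoop⇒1<∣T∣ S-edges T-vertices e∈S λ ())
  incident-everywhere : ∀ e v → Incident (parallel m) e v
  incident-everywhere e zero       = inj₁ refl
  incident-everywhere e (suc zero) = inj₂ refl
  avoiding-empty : ∀ v → ∣ EdgesAvoiding (parallel m) v ∣ < 2
  avoiding-empty v = subst (_< 2) (sym (Empty⇒∣p∣≡0 λ (e , avoids) →
    to ∈EdgesAvoiding⇔ avoids (incident-everywhere e v))) (s≤s z≤n)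
  qg4 : QG4 (U 2 m) (parallel m)
  qg4 _ _ = zero , suc zero , λ { zero _ → inj₁ (here zero) ; (suc zero) _ → inj₂ (here (suc zero)) }

opposite-side : Fin 3 → Fin 3 × Fin 3
opposite-side zero             = suc zero , suc (suc zero)
opposite-side (suc zero)       = zero , suc (suc zero)
opposite-side (suc (suc zero)) = zero , suc zero

-- Edge e is put on the side opposite vertex (e mod 3), so with at most six edges
-- each side carries at most two of them.
triangle : ∀ m → Graph 3 m
triangle m = record { ends = λ e → opposite-side (toℕ e mod 3) }

triangle-∣avoiding∣≤2 : ∀ {m} → m ≤ 6 → ∀ v → ∣ EdgesAvoiding (triangle m) v ∣ ≤ 2
triangle-∣avoiding∣≤2 {m} m≤6 v =
  subst (λ m → ∣ EdgesAvoiding (triangle m) v ∣ ≤ 2) (toℕ-fromℕ< (s≤s m≤6))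
        (checked (fromℕ< (s≤s m≤6)) v)
  where
  checked : ∀ (i : Fin 7) v → ∣ EdgesAvoiding (triangle (toℕ i)) v ∣ ≤ 2
  checked = toWitness {a? = all? λ i → all? λ v → ∣ EdgesAvoiding (triangle (toℕ i)) v ∣ ≤? 2} _

U₃-quasiGraphic : ∀ {m} → m ≤ 6 → QuasiGraphic (U 3 m)
U₃-quasiGraphic {m} m≤6 = 3 , triangle m , U-QG2 qg2 , U-QG3 (s≤s ∘ ∣avoiding∣≤2) , qg4
  where
  open GraphLemmas (triangle m)
  ∣avoiding∣≤2 : ∀ v → ∣ EdgesAvoiding (triangle m) v ∣ ≤ 2
  ∣avoiding∣≤2 = triangle-∣avoiding∣≤2 m≤6

  loopless : ∀ e → ¬ IsLoop e
  loopless e with toℕ e mod 3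
  ... | zero             = λ ()
  ... | suc zero         = λ ()
  ... | suc (suc zero)   = λ ()

  qg2 : ∀ {u S T} → ComponentEdges u S → ComponentVertices u T → Nonempty S → 3 ⊓ ∣ S ∣ ≤ ∣ T ∣
  qg2 {S = S} {T} S-edges T-vertices (e , e∈S) with ∣ T ∣ <? 3
  ... | no ∣T∣≮3 = ≤-trans (m⊓n≤m 3 ∣ S ∣) (≮⇒≥ ∣T∣≮3)
  ... | yes ∣T∣<3 = let (w , w∉T) = ∣p∣<n⇒∃∉ ∣T∣<3 in begin
    3 ⊓ ∣ S ∣                         ≤⟨ m⊓n≤n 3 ∣ S ∣ ⟩
    ∣ S ∣                             ≤⟨ p⊆q⇒∣p∣≤∣q∣ (component-avoids S-edges T-vertices w∉T) ⟩
    ∣ EdgesAvoiding (triangle m) w ∣  ≤⟨ ∣avoiding∣≤2 w ⟩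
    2                                 ≤⟨ component-nonLoop⇒1<∣T∣ S-edges T-vertices e∈S (loopless e) ⟩
    ∣ T ∣                             ∎
    where open ≤-Reasoning

  from-0-or-1 : ∀ {C v} x → x ≢ suc (suc zero) → Conn (triangle m) C x v →
                Conn (triangle m) C zero v ⊎ Conn (triangle m) C (suc zero) v
  from-0-or-1 zero             _   x~v = inj₁ x~v
  from-0-or-1 (suc zero)       _   x~v = inj₂ x~v
  from-0-or-1 (suc (suc zero)) x≢2 _   = contradiction refl x≢2

  qg4 : QG4 (U 3 m) (triangle m)
  qg4 C _ = zero , suc zero , reach
    where
    reach : ∀ v → ∃[ e ] (e ∈ C × Incident (triangle m) e v) →
            Conn (triangle m) C zero v ⊎ Conn (triangle m) C (suc zero) v
    reach zero             _ = inj₁ (here zero)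
    reach (suc zero)       _ = inj₂ (here (suc zero))
    reach (suc (suc zero)) (e , e∈C , inj₁ e₁≡2) = from-0-or-1 (end₂ e)
      (λ e₂≡2 → loopless e (trans e₁≡2 (sym e₂≡2)))
      (subst (Conn (triangle m) C (end₂ e)) e₁≡2 (Conn-sym (Conn-edge e∈C)))
    reach (suc (suc zero)) (e , e∈C , inj₂ e₂≡2) = from-0-or-1 (end₁ e)
      (λ e₁≡2 → loopless e (trans e₁≡2 (sym e₂≡2)))
      (subst (Conn (triangle m) C (end₁ e)) e₂≡2 (Conn-edge e∈C))

-- U_{3,n} is not quasi-graphic for n ≥ 7

module NoFramework (k : ℕ) {V : ℕ} (H : Graph V (7 + k))
  (qg2 : QG2 (U 3 (7 + k)) H) (qg3 : QG3 (U 3 (7 + k)) H) (qg4 : QG4 (U 3 (7 + k)) H) where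
  open GraphLemmas H

  nonLoop⇒∣avoiding∣≤2 : ∀ {e v} → Incident H e v → ¬ IsLoop e → ∣ EdgesAvoiding H v ∣ ≤ 2
  nonLoop⇒∣avoiding∣≤2 {e} {v} incident nonLoop = ≮⇒≥ λ 2<∣avoiding∣ →
    QG3⇒nonLoop∉closure {N = U 3 (7 + k)} qg3 incident nonLoop
      (U-spanning⇒closure (EdgesAvoiding H v) e 2<∣avoiding∣)

  ¬three-small-avoiders : ∀ {u w x} → u ≢ w → u ≢ x → w ≢ x →
    ∣ EdgesAvoiding H u ∣ ≤ 2 → ∣ EdgesAvoiding H w ∣ ≤ 2 → ∣ EdgesAvoiding H x ∣ ≤ 2 → Empty⊥
  ¬three-small-avoiders u≢w u≢x w≢x ≤2-u ≤2-w ≤2-x = 7+k≰6 (≤-trans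
    (covered⇒n≤∣p∣+∣q∣+∣r∣ (avoids-one-of-three u≢w u≢x w≢x))
    (+-mono-≤ ≤2-u (+-mono-≤ ≤2-w ≤2-x)))
    where
    7+k≰6 : ¬ (7 + k ≤ 6)
    7+k≰6 (s≤s (s≤s (s≤s (s≤s (s≤s (s≤s ()))))))

  module _ (Conn? : ∀ u v → Dec (Conn H (allEdges H) u v)) where

    componentEdges : Fin V → Subset (7 + k)
    componentEdges u = tabulate (λ e → ⌊ Conn? u (end₁ e) ⌋)

    componentVertices : Fin V → Subset V
    componentVertices u = tabulate (λ v → ⌊ Conn? u v ⌋)

    componentEdges-spec : ∀ u → ComponentEdges u (componentEdges u)
    componentEdges-spec u = ∈-tabulate-isYes⇔ (λ e → Conn? u (end₁ e))

    componentVertices-spec : ∀ u → ComponentVertices u (componentVertices u)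
    componentVertices-spec u = ∈-tabulate-isYes⇔ (Conn? u)

    2<∣componentVertices∣ : ∀ {u} → ∣ EdgesAvoiding H u ∣ ≤ 2 → 2 < ∣ componentVertices u ∣
    2<∣componentVertices∣ {u} ≤2-u = begin
      3                                ≡⟨ m≤n⇒m⊓n≡m 3≤∣edges∣ ⟨
      3 ⊓ ∣ componentEdges u ∣         ≤⟨ qg2 u _ _ (componentEdges-spec u) (componentVertices-spec u) ⟩
      ∣ componentVertices u ∣          ∎
      where
      open ≤-Reasoning
      incident⇒∈edges : ∀ {e} → Incident H e u → e ∈ componentEdges u
      incident⇒∈edges (inj₁ refl) = from (componentEdges-spec u _) (here _)
      incident⇒∈edges (inj₂ refl) =
        from (componentEdges-spec u _) (Conn-sym (Conn-edge (∈allEdges _)))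
      7+k≤2+∣edges∣ : 7 + k ≤ 2 + ∣ componentEdges u ∣
      7+k≤2+∣edges∣ = ≤-trans (covered⇒n≤∣p∣+∣q∣ λ e → Sum.map₂ incident⇒∈edges (avoids⊎incident e u))
                              (+-monoˡ-≤ _ ≤2-u)
      3≤∣edges∣ : 3 ≤ ∣ componentEdges u ∣
      3≤∣edges∣ = ≤-trans (m≤m+n 3 (2 + k)) (+-cancelˡ-≤ 2 _ _ 7+k≤2+∣edges∣)

    edges-are-loops : ∀ e → IsLoop e
    edges-are-loops e = decidable-stable (end₁ e ≟ end₂ e) λ u≢w →
      let ≤2-u = nonLoop⇒∣avoiding∣≤2 (inj₁ refl) u≢w
          ≤2-w = nonLoop⇒∣avoiding∣≤2 (inj₂ refl) u≢w
          (x , x∈ , x≢u , x≢w) = 2<∣p∣⇒∃-other (end₁ e) (end₂ e) (2<∣componentVertices∣ ≤2-u)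
          (f , f-incident , f-nonLoop) =
            Conn⇒incident-nonLoop (Conn-sym (to (componentVertices-spec _ x) x∈)) x≢u
      in ¬three-small-avoiders u≢w (x≢u ∘ sym) (x≢w ∘ sym)
           ≤2-u ≤2-w (nonLoop⇒∣avoiding∣≤2 f-incident f-nonLoop)

  loops⇒one-per-vertex : (∀ e → IsLoop e) → ∀ {f g} → end₁ f ≡ end₁ g → f ≡ g
  loops⇒one-per-vertex loops {f} {g} f~g = decidable-stable (f ≟ g) λ f≢g →
    <⇒≱ (x≢y⇒1<∣p∣ (from (loops-at f) refl) (from (loops-at g) (sym f~g)) f≢g) ∣S∣≤1
    where
    u = end₁ f
    S = tabulate (λ e → ⌊ end₁ e ≟ u ⌋)
    loops-at : ∀ e → e ∈ S ⇔ (end₁ e ≡ u)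
    loops-at = ∈-tabulate-isYes⇔ (λ e → end₁ e ≟ u)
    same-vertex⇔Conn : ∀ v → v ≡ u ⇔ Conn H (allEdges H) u v
    same-vertex⇔Conn v = mk⇔ (λ { refl → here u }) (sym ∘ loops⇒Conn⇒≡ loops)
    ∣S∣≤1 : ∣ S ∣ ≤ 1
    ∣S∣≤1 = m⊓n≤o⇒n≤o (s≤s (s≤s z≤n)) (subst (3 ⊓ ∣ S ∣ ≤_) (∣⁅x⁆∣≡1 u)
      (qg2 u S ⁅ u ⁆ (λ e → ⇔.trans (loops-at e) (same-vertex⇔Conn (end₁ e)))
                     (λ v → ⇔.trans x∈⁅y⁆⇔x≡y (same-vertex⇔Conn v))))

  C₄ : Subset (7 + k)
  C₄ = inside ∷ inside ∷ inside ∷ inside ∷ ⊥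

  ¬edges-are-loops : ¬ (∀ e → IsLoop e)
  ¬edges-are-loops loops with qg4 C₄ (U-circuit (cong (4 +_) (∣⊥∣≡0 (3 + k))))
  ... | a , b , covered = distinct (pigeonhole (at here) (at (there here)) (at (there (there here))))
    where
    at : ∀ {i} → i ∈ C₄ → a ≡ end₁ i ⊎ b ≡ end₁ i
    at {i} i∈C₄ = Sum.map (loops⇒Conn⇒≡ loops) (loops⇒Conn⇒≡ loops)
                          (covered (end₁ i) (i , i∈C₄ , inj₁ refl))
    distinct : end₁ zero ≡ end₁ (suc zero) ⊎ end₁ zero ≡ end₁ (suc (suc zero)) ⊎
               end₁ (suc zero) ≡ end₁ (suc (suc zero)) → Empty⊥
    distinct (inj₁ same)        = contradiction (loops⇒one-per-vertex loops same) λ ()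
    distinct (inj₂ (inj₁ same)) = contradiction (loops⇒one-per-vertex loops same) λ ()
    distinct (inj₂ (inj₂ same)) = contradiction (loops⇒one-per-vertex loops same) λ ()

¬U₃-quasiGraphic : ∀ k → ¬ QuasiGraphic (U 3 (7 + k))
¬U₃-quasiGraphic k (V , H , qg2 , qg3 , qg4) =
  Conn-decidable λ Conn? → ¬edges-are-loops (edges-are-loops Conn?)
  where
  open NoFramework k H qg2 qg3 qg4
  -- Connectivity need not be decidable constructively, but as the goal is ⊥ we may assume it.
  Conn-decidable : ¬ ¬ (∀ u v → Dec (Conn H (allEdges H) u v))
  Conn-decidable = ¬¬-∀-Fin V λ u → ¬¬-∀-Fin V λ v → ¬¬-excluded-middle

-- Proper minors of U_{3,7}

U[3∸c]-quasiGraphic : ∀ c {m} → m ≤ 6 → QuasiGraphic (U (3 ∸ c) m)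
U[3∸c]-quasiGraphic zero          m≤6 = U₃-quasiGraphic m≤6
U[3∸c]-quasiGraphic (suc zero)    _   = U₂-quasiGraphic _
U[3∸c]-quasiGraphic (suc (suc c)) {m} _ =
  rank≤1⇒quasiGraphic {N = U (1 ∸ c) m} λ X → ≤-trans (m⊓n≤m (1 ∸ c) ∣ X ∣) (m∸n≤m 1 c)

properMinor-U₃,₇-quasiGraphic : ∀ m (N : Matroid m) → IsProperMinor N U₃,₇ → QuasiGraphic N
properMinor-U₃,₇-quasiGraphic m N (C , D , (_ , z∈C∪D) , minor) =
  quasiGraphic-resp {M = U (3 ∸ ∣ C ∣) m} {N} (sym ∘ proj₁ U₃,₇-minor) (U[3∸c]-quasiGraphic ∣ C ∣ m≤6)
  where
  U₃,₇-minor : (∀ X → rank N X ≡ rank (U (3 ∸ ∣ C ∣) m) X) × ∣ C ∪ D ∣ + m ≤ 7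
  U₃,₇-minor = uniform-minor {r = 3} {N = N} minor
  m≤6 : m ≤ 6
  m≤6 = s≤s⁻¹ (≤-trans (+-monoˡ-≤ m (x∈p⇒0<∣p∣ z∈C∪D)) (proj₂ U₃,₇-minor))

theorem3p1 : ¬ QuasiGraphic U₃,₇ ×
             (∀ (m : ℕ) (N : Matroid m) → IsProperMinor N U₃,₇ → QuasiGraphic N)
theorem3p1 = ¬U₃-quasiGraphic 0 , properMinor-U₃,₇-quasiGraphic
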